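{- For all positive integers $p$ and $q$, $$\operatorname{aw}_u(\mathbb{Z}_p,3) + \operatorname{aw}_u(\mathbb{Z}_q,3) - 2 \le \operatorname{aw}_u(\mathbb{Z}_p \times \mathbb{Z}_q, 3).$$
   Context: $\mathbb{Z}_m$ is the cyclic group $\{0,\dots,m-1\}$ under addition mod $m$. A $k$-term arithmetic progression ($k$-AP) in an abelian group $H$ is a sequence $a, a+d, \dots, a+(k-1)d$ with $a,d \in H$ (degenerate ones allowed). An $r$-coloring of $H$ is a function $c: H \to \{1,\dots,r\}$; it is exact if surjective. A $k$-AP is rainbow under $c$ if $c(a+id) \neq c(a+jd)$ for all $0 \le i < j \le k-1$. A coloring is unitary if some element of $H$ receives a color used on no other element. The unitary anti-van der Waerden number $\operatorname{aw}_u(H,k)$ is the smallest $r$ such that every exact unitary $r$-coloring of $H$ contains a rainbow $k$-AP; if $H$ has no $k$-AP, $\operatorname{aw}_u(H,k)=|H|+1$. -}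

module Defs where

open import Data.Nat using (ℕ; zero; suc; _+_; _≤_; _<_; NonZero)
open import Data.Nat.DivMod using (_%_; m%n<n)
open import Data.Fin using (Fin; toℕ; fromℕ<)
open import Data.Product using (Σ; ∃; ∃-syntax; _×_; _,_)
open import Relation.Binary.PropositionalEquality using (_≡_; _≢_)
open import Relation.Nullary using (¬_)

-- An abelian group is represented by its carrier and its addition
-- (only the addition is needed to speak about arithmetic progressions).

ℤ/ : (m : ℕ) → Set
ℤ/ m = Fin m

addMod : (m : ℕ) .{{_ : NonZero m}} → Fin m → Fin m → Fin m
addMod m x y = fromℕ< (m%n<n (toℕ x + toℕ y) m)

addProd : {A B : Set} → (A → A → A) → (B → B → B) → A × B → A × B → A × B
addProd _+A_ _+B_ (a₁ , b₁) (a₂ , b₂) = (a₁ +A a₂) , (b₁ +B b₂)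

step : {G : Set} → (G → G → G) → G → G → ℕ → G
step _⊕_ a d zero = a
step _⊕_ a d (suc i) = step _⊕_ a d i ⊕ d

Exact : {G : Set} {r : ℕ} → (G → Fin r) → Set
Exact {G} {r} c = (j : Fin r) → ∃[ x ] c x ≡ j

Unitary : {G : Set} {r : ℕ} → (G → Fin r) → Set
Unitary {G} c = ∃[ x ] ((y : G) → c y ≡ c x → y ≡ x)

-- a rainbow k-AP a, a+d, …, a+(k-1)d (degenerate d allowed)
HasRainbowAP : {G : Set} {r : ℕ} → (G → G → G) → ℕ → (G → Fin r) → Set
HasRainbowAP {G} _⊕_ k c =
  ∃[ a ] ∃[ d ] ((i j : ℕ) → i < j → j < k →
    c (step _⊕_ a d i) ≢ c (step _⊕_ a d j))

AllRainbow : (G : Set) → (G → G → G) → ℕ → ℕ → Set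
AllRainbow G _⊕_ k r =
  (c : G → Fin r) → Exact c → Unitary c → HasRainbowAP _⊕_ k c

IsAwu : (G : Set) → (G → G → G) → ℕ → ℕ → Set
IsAwu G _⊕_ k r =
  2 ≤ r × AllRainbow G _⊕_ k r
    × ((s : ℕ) → 2 ≤ s → s < r → ¬ AllRainbow G _⊕_ k s)

-- Let c₁ and c₂ be exact unitary colourings of ℤ/p and ℤ/q with s + 1 and t + 1 colours and
-- no rainbow 3-AP; translating and permuting colours, ε is the only point of colour 0. Such a
-- colouring is invariant under x ↦ -x and under x ↦ 2x (when 2x ≠ 0), so it is constant on the
-- nonzero elements of 2-power order, all of which double down to the unique element of order 2.
-- Colour (x, y) by c₁ x if the 2-part of the order of x exceeds that of y and by c₂ y otherwise,
-- sharing colour 0: an exact unitary colouring of ℤ/p × ℤ/q with s + t + 1 colours. Multiplying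
-- by a large power 2^N keeps colours away from its kernel, so a rainbow 3-AP would lie either in
-- the 2-primary part, which sees only two colours, or (after scaling) in the odd part, where the
-- colouring is c₁ on ℤ/p × {0} and c₂ elsewhere; neither is possible. Taking s + 1 and t + 1 below
-- aw_u(ℤ/p, 3) and aw_u(ℤ/q, 3) with s + t + 1 = aw_u(ℤ/p × ℤ/q, 3) gives the inequality.

module Submission where

open import Defs
open import Level using (0ℓ)
open import Algebra.Bundles using (AbelianGroup)
open import Algebra.Consequences.Propositional using (comm∧idˡ⇒id; comm∧invˡ⇒inv)
open import Algebra.Core using (Op₁; Op₂)
open import Algebra.Definitions using (Associative; Commutative; LeftIdentity; LeftInverse)
import Algebra.Properties.AbelianGroup as AbelianGroupProperties
import Algebra.Properties.CommutativeSemigroup as CommutativeSemigroupProperties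
open import Algebra.Structures using (IsAbelianGroup)
open import Data.Bool using (if_then_else_)
open import Data.Empty using (⊥; ⊥-elim)
open import Data.Fin using (Fin; suc; toℕ; fromℕ<; _↑ˡ_; _↑ʳ_; splitAt)
open import Data.Fin.Patterns using (0F; 1F)
open import Data.Fin.Permutation using (Permutation′; transpose; _⟨$⟩ʳ_; _⟨$⟩ˡ_)
import Data.Fin.Permutation as Permutation
open import Data.Fin.Properties
  using (any?; toℕ-fromℕ<; toℕ<n; toℕ-injective; ↑ˡ-injective; ↑ʳ-injective; splitAt⁻¹-↑ˡ; splitAt⁻¹-↑ʳ)
  renaming (_≟_ to _≟ᶠ_)
open import Data.Nat
  using (ℕ; zero; suc; z<s; z≤n; s≤s; s≤s⁻¹; s<s⁻¹; _+_; _*_; _∸_; _^_; _≤_; _<_; NonZero; >-nonZero; >-nonZero⁻¹)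
open import Data.Nat.DivMod using (_%_; m%n<n; %-distribˡ-+; m%n%n≡m%n; m<n⇒m%n≡m; n%n≡0)
open import Data.Nat.Divisibility
  using (_∣_; divides; ∣m+n∣m⇒∣n; ∣n⇒∣m*n; m∣m*n; *-monoʳ-∣; *-cancelˡ-∣; m%n≡0⇒n∣m; n∣m⇒m%n≡0)
open import Data.Nat.Properties
  using ( +-assoc; +-comm; +-identityʳ; +-suc; *-assoc; *-comm; *-identityˡ; *-suc; *-cancelˡ-≡
        ; ≤-refl; ≤-trans; <⇒≤; <⇒≢; ≰⇒>; ≮⇒≥; n≤1+n; n<1+n; m<n⇒m<1+n; m≤m+n; m≤n+m
        ; m≤n⇒m<n∨m≡n; m+n≤o⇒m≤o; m+n≤o⇒n≤o; m+n≤o⇒m≤o∸n; m<n+o⇒m∸n<o; m+[n∸m]≡n; m∸n+n≡m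
        ; *-monoˡ-≤; *-monoʳ-<; suc-injective; _≤?_; _<?_; anyUpTo?; module ≤-Reasoning )
open import Data.Product using (Σ; ∃₂; ∃-syntax; _×_; _,_; proj₁; proj₂)
open import Data.Product.Properties using (≡-dec)
open import Data.Sum using (_⊎_; inj₁; inj₂)
import Data.Sum as Sum
open import Data.Unit using (⊤)
open import Function using (_∘_)
open import Relation.Binary.Definitions using (DecidableEquality)
open import Relation.Binary.PropositionalEquality
open import Relation.Binary.PropositionalEquality.Algebra using (isMagma)
open import Relation.Nullary using (¬_; Dec; yes; no; ¬?; does; contradiction)
open import Relation.Nullary.Decidable using (_×-dec_; dec-true; dec-false; decidable-stable)

record DecAbelianGroup : Set₁ where
  infixl 7 _∙_
  infix  8 _⁻¹
  field
    Carrier        : Set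
    _∙_            : Op₂ Carrier
    ε              : Carrier
    _⁻¹            : Op₁ Carrier
    isAbelianGroup : IsAbelianGroup _≡_ _∙_ ε _⁻¹
    _≟_            : DecidableEquality Carrier

  abelianGroup : AbelianGroup 0ℓ 0ℓ
  abelianGroup = record { isAbelianGroup = isAbelianGroup }

  open IsAbelianGroup isAbelianGroup public
    using (assoc; comm; identityˡ; identityʳ; inverseˡ)
  open AbelianGroupProperties abelianGroup public
    using ( inverseˡ-unique; inverseʳ-unique; ε⁻¹≈ε; ⁻¹-involutive; ⁻¹-∙-comm; ∙-cancelʳ
          ; x≈z//y; //-rightDividesˡ )
  open CommutativeSemigroupProperties (AbelianGroup.commutativeSemigroup abelianGroup) public
    using (interchange; xy∙z≈xz∙y)

  ⁻¹≡ε⇒≡ε : ∀ {x} → x ⁻¹ ≡ ε → x ≡ ε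
  ⁻¹≡ε⇒≡ε {x} eq = trans (sym (⁻¹-involutive x)) (trans (cong _⁻¹ eq) ε⁻¹≈ε)

  double : Carrier → Carrier
  double x = x ∙ x

  double-ε : double ε ≡ ε
  double-ε = identityˡ ε

  ε∙x∙x≡double : ∀ x → ε ∙ x ∙ x ≡ double x
  ε∙x∙x≡double x = cong (_∙ x) (identityˡ x)

  x∙y∙y≡ε⇒x≡double[x∙y] : ∀ {x y} → x ∙ y ∙ y ≡ ε → x ≡ double (x ∙ y)
  x∙y∙y≡ε⇒x≡double[x∙y] {x} {y} x∙y∙y≡ε = begin
    x                   ≡⟨ x≈z//y x y (x ∙ y) refl ⟩
    x ∙ y ∙ y ⁻¹        ≡⟨ cong (λ t → x ∙ y ∙ t ⁻¹) (inverseʳ-unique (x ∙ y) y x∙y∙y≡ε) ⟩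
    x ∙ y ∙ (x ∙ y) ⁻¹ ⁻¹ ≡⟨ cong (x ∙ y ∙_) (⁻¹-involutive (x ∙ y)) ⟩
    double (x ∙ y)      ∎
    where open ≡-Reasoning

  AP-ε₀₁ : ∀ {a d} → a ≡ ε → a ∙ d ≡ ε → d ≡ ε
  AP-ε₀₁ {a} {d} refl ε∙d≡ε = trans (sym (identityˡ d)) ε∙d≡ε

  AP-ε₀₂ : ∀ {a d} → a ≡ ε → a ∙ d ∙ d ≡ ε → double d ≡ ε
  AP-ε₀₂ {a} {d} refl ε∙d∙d≡ε = trans (sym (ε∙x∙x≡double d)) ε∙d∙d≡ε

  AP-ε₁₂ : ∀ {a d} → a ∙ d ≡ ε → a ∙ d ∙ d ≡ ε → a ≡ ε × d ≡ ε
  AP-ε₁₂ {a} {d} a∙d≡ε a∙d∙d≡ε = a≡ε , d≡ε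
    where
    d≡ε = AP-ε₀₁ a∙d≡ε a∙d∙d≡ε
    a≡ε = trans (sym (identityʳ a)) (trans (cong (a ∙_) (sym d≡ε)) a∙d≡ε)

  double^ : ℕ → Carrier → Carrier
  double^ zero    x = x
  double^ (suc j) x = double (double^ j x)

  double^-suc : ∀ j x → double^ (suc j) x ≡ double^ j (double x)
  double^-suc zero    x = refl
  double^-suc (suc j) x = cong double (double^-suc j x)

  double^-+ : ∀ i j x → double^ (i + j) x ≡ double^ i (double^ j x)
  double^-+ zero    j x = refl
  double^-+ (suc i) j x = cong double (double^-+ i j x)

  double^-∙ : ∀ j x y → double^ j (x ∙ y) ≡ double^ j x ∙ double^ j y
  double^-∙ zero    x y = refl
  double^-∙ (suc j) x y =
    trans (cong double (double^-∙ j x y)) (interchange (double^ j x) (double^ j y) _ _)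

  double^-AP₂ : ∀ j a d → double^ j (a ∙ d ∙ d) ≡ double^ j a ∙ double^ j d ∙ double^ j d
  double^-AP₂ j a d = trans (double^-∙ j (a ∙ d) d) (cong (_∙ double^ j d) (double^-∙ j a d))

  double^-⁻¹ : ∀ j x → double^ j (x ⁻¹) ≡ double^ j x ⁻¹
  double^-⁻¹ zero    x = refl
  double^-⁻¹ (suc j) x = trans (cong double (double^-⁻¹ j x)) (⁻¹-∙-comm _ _)

  double^-ε : ∀ j → double^ j ε ≡ ε
  double^-ε zero    = refl
  double^-ε (suc j) = trans (cong double (double^-ε j)) double-ε

  HasOrderTwo : Carrier → Set
  HasOrderTwo x = x ≢ ε × double x ≡ ε

  AtMostOneOrderTwo : Set
  AtMostOneOrderTwo = ∀ {x y} → HasOrderTwo x → HasOrderTwo y → x ≡ y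

  -- 2^N annihilates every element of 2-power order.
  DoublingStabilises : ℕ → Set
  DoublingStabilises N = ∀ j x → N ≤ j → double^ (suc j) x ≡ ε → double^ j x ≡ ε

  double^-image-2-torsion-free : ∀ {N} → DoublingStabilises N →
    ∀ k x → double^ k (double^ N x) ≡ ε → double^ N x ≡ ε
  double^-image-2-torsion-free         stable zero    x eq = eq
  double^-image-2-torsion-free {N} stable (suc k) x eq =
    double^-image-2-torsion-free stable k x
      (trans (sym (double^-+ k N x))
        (stable (k + N) x (m≤n+m N k) (trans (double^-+ (suc k) N x) eq)))

  double^-reaches-order-two : ∀ k x → x ≢ ε → double^ k x ≡ ε →
    ∃[ i ] HasOrderTwo (double^ i x)
  double^-reaches-order-two zero    x x≢ε eq = ⊥-elim (x≢ε eq)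
  double^-reaches-order-two (suc k) x x≢ε eq with double x ≟ ε
  ... | yes 2x≡ε = 0 , x≢ε , 2x≡ε
  ... | no  2x≢ε with double^-reaches-order-two k (double x) 2x≢ε (trans (sym (double^-suc k x)) eq)
  ...   | i , order-two = suc i , subst HasOrderTwo (sym (double^-suc i x)) order-two

isAbelianGroup-≡ : {A : Set} {_∙_ : Op₂ A} {ε : A} {_⁻¹ : Op₁ A} →
  Associative _≡_ _∙_ → Commutative _≡_ _∙_ → LeftIdentity _≡_ ε _∙_ →
  LeftInverse _≡_ ε _⁻¹ _∙_ → IsAbelianGroup _≡_ _∙_ ε _⁻¹
isAbelianGroup-≡ {_∙_ = _∙_} {_⁻¹ = _⁻¹} assoc comm identityˡ inverseˡ = record
  { isGroup = record
    { isMonoid = record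
      { isSemigroup = record { isMagma = isMagma _∙_ ; assoc = assoc }
      ; identity    = comm∧idˡ⇒id comm identityˡ
      }
    ; inverse = comm∧invˡ⇒inv comm inverseˡ
    ; ⁻¹-cong = cong _⁻¹
    }
  ; comm = comm
  }

parity : ∀ d → ∃[ k ] (d ≡ 2 * k ⊎ d ≡ 1 + 2 * k)
parity zero = 0 , inj₁ refl
parity (suc d) with parity d
... | k , inj₁ d≡2k   = k , inj₂ (cong suc d≡2k)
... | k , inj₂ d≡1+2k = suc k , inj₁ (trans (cong suc d≡1+2k) (sym (*-suc 2 k)))

odd∣2*⇒∣ : ∀ k X → 1 + 2 * k ∣ 2 * X → 1 + 2 * k ∣ X
odd∣2*⇒∣ k X d∣2X = ∣m+n∣m⇒∣n d∣2kX+X d∣2kX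
  where
  d∣2kX : 1 + 2 * k ∣ 2 * k * X
  d∣2kX = subst (1 + 2 * k ∣_) (trans (sym (*-assoc k 2 X)) (cong (_* X) (*-comm k 2))) (∣n⇒∣m*n k d∣2X)
  d∣2kX+X : 1 + 2 * k ∣ 2 * k * X + X
  d∣2kX+X = subst (1 + 2 * k ∣_) (+-comm X (2 * k * X)) (m∣m*n X)

-- A positive d ≤ j cannot contain more than j factors 2.
∣2^suc*⇒∣2^* : ∀ j w {d} → 0 < d → d ≤ j → d ∣ 2 ^ suc j * w → d ∣ 2 ^ j * w
∣2^suc*⇒∣2^* j w {d} 0<d d≤j d∣ with parity d
... | k , inj₂ refl = odd∣2*⇒∣ k (2 ^ j * w) (subst (1 + 2 * k ∣_) (*-assoc 2 (2 ^ j) w) d∣)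
∣2^suc*⇒∣2^* j       w 0<d d≤j d∣ | zero  , inj₁ refl = contradiction 0<d (λ ())
∣2^suc*⇒∣2^* zero    w 0<d d≤j d∣ | suc k , inj₁ refl = contradiction d≤j (λ ())
∣2^suc*⇒∣2^* (suc j) w 0<d d≤j d∣ | suc k , inj₁ refl =
  subst (2 * suc k ∣_) (sym (*-assoc 2 (2 ^ j) w)) (*-monoʳ-∣ 2 k∣2^jw)
  where
  k∣2^jw : suc k ∣ 2 ^ j * w
  k∣2^jw = ∣2^suc*⇒∣2^* j w z<s
              (≤-trans (m≤n+m (suc k) k) (subst (λ t → k + suc t ≤ j) (+-identityʳ k) (s≤s⁻¹ d≤j)))
              (*-cancelˡ-∣ 2 (subst (2 * suc k ∣_) (*-assoc 2 (2 ^ suc j) w) d∣))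

module Cyclic (n : ℕ) .{{_ : NonZero n}} where

  infixl 7 _⊕_
  _⊕_ : Op₂ (ℤ/ n)
  _⊕_ = addMod n

  ⊖_ : Op₁ (ℤ/ n)
  ⊖ x = fromℕ< (m%n<n (n ∸ toℕ x) n)

  toℕ-⊕ : ∀ x y → toℕ (x ⊕ y) ≡ (toℕ x + toℕ y) % n
  toℕ-⊕ x y = toℕ-fromℕ< (m%n<n (toℕ x + toℕ y) n)

  toℕ%n : ∀ (x : ℤ/ n) → toℕ x % n ≡ toℕ x
  toℕ%n x = m<n⇒m%n≡m (toℕ<n x)

  [m%n+k]%n : ∀ m k → (m % n + k) % n ≡ (m + k) % n
  [m%n+k]%n m k = begin
    (m % n + k) % n          ≡⟨ %-distribˡ-+ (m % n) k n ⟩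
    (m % n % n + k % n) % n  ≡⟨ cong (λ w → (w + k % n) % n) (m%n%n≡m%n m n) ⟩
    (m % n + k % n) % n      ≡⟨ %-distribˡ-+ m k n ⟨
    (m + k) % n              ∎
    where open ≡-Reasoning

  [m+k%n]%n : ∀ m k → (m + k % n) % n ≡ (m + k) % n
  [m+k%n]%n m k = begin
    (m + k % n) % n  ≡⟨ cong (_% n) (+-comm m (k % n)) ⟩
    (k % n + m) % n  ≡⟨ [m%n+k]%n k m ⟩
    (k + m) % n      ≡⟨ cong (_% n) (+-comm k m) ⟩
    (m + k) % n      ∎
    where open ≡-Reasoning

  ⊕-assoc : Associative _≡_ _⊕_
  ⊕-assoc x y z = toℕ-injective (begin
    toℕ (x ⊕ y ⊕ z)                    ≡⟨ toℕ-⊕ (x ⊕ y) z ⟩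
    (toℕ (x ⊕ y) + toℕ z) % n          ≡⟨ cong (λ w → (w + toℕ z) % n) (toℕ-⊕ x y) ⟩
    ((toℕ x + toℕ y) % n + toℕ z) % n  ≡⟨ [m%n+k]%n (toℕ x + toℕ y) (toℕ z) ⟩
    (toℕ x + toℕ y + toℕ z) % n        ≡⟨ cong (_% n) (+-assoc (toℕ x) (toℕ y) (toℕ z)) ⟩
    (toℕ x + (toℕ y + toℕ z)) % n      ≡⟨ [m+k%n]%n (toℕ x) (toℕ y + toℕ z) ⟨
    (toℕ x + (toℕ y + toℕ z) % n) % n  ≡⟨ cong (λ w → (toℕ x + w) % n) (toℕ-⊕ y z) ⟨
    (toℕ x + toℕ (y ⊕ z)) % n          ≡⟨ toℕ-⊕ x (y ⊕ z) ⟨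
    toℕ (x ⊕ (y ⊕ z))                  ∎)
    where open ≡-Reasoning

  ⊕-comm : Commutative _≡_ _⊕_
  ⊕-comm x y = toℕ-injective (begin
    toℕ (x ⊕ y)            ≡⟨ toℕ-⊕ x y ⟩
    (toℕ x + toℕ y) % n    ≡⟨ cong (_% n) (+-comm (toℕ x) (toℕ y)) ⟩
    (toℕ y + toℕ x) % n    ≡⟨ toℕ-⊕ y x ⟨
    toℕ (y ⊕ x)            ∎)
    where open ≡-Reasoning

  0# : ℤ/ n
  0# = fromℕ< (>-nonZero⁻¹ n)

  toℕ-0# : toℕ 0# ≡ 0
  toℕ-0# = toℕ-fromℕ< (>-nonZero⁻¹ n)

  ⊕-identityˡ : LeftIdentity _≡_ 0# _⊕_
  ⊕-identityˡ x = toℕ-injective (begin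
    toℕ (0# ⊕ x)            ≡⟨ toℕ-⊕ 0# x ⟩
    (toℕ 0# + toℕ x) % n    ≡⟨ cong (λ w → (w + toℕ x) % n) toℕ-0# ⟩
    toℕ x % n               ≡⟨ toℕ%n x ⟩
    toℕ x                   ∎)
    where open ≡-Reasoning

  ⊕-inverseˡ : LeftInverse _≡_ 0# ⊖_ _⊕_
  ⊕-inverseˡ x = toℕ-injective (begin
    toℕ (⊖ x ⊕ x)                  ≡⟨ toℕ-⊕ (⊖ x) x ⟩
    (toℕ (⊖ x) + toℕ x) % n        ≡⟨ cong (λ w → (w + toℕ x) % n) (toℕ-fromℕ< (m%n<n (n ∸ toℕ x) n)) ⟩
    ((n ∸ toℕ x) % n + toℕ x) % n  ≡⟨ [m%n+k]%n (n ∸ toℕ x) (toℕ x) ⟩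
    (n ∸ toℕ x + toℕ x) % n        ≡⟨ cong (_% n) (m∸n+n≡m (<⇒≤ (toℕ<n x))) ⟩
    n % n                          ≡⟨ n%n≡0 n ⟩
    0                              ≡⟨ toℕ-0# ⟨
    toℕ 0#                         ∎)
    where open ≡-Reasoning

  group : DecAbelianGroup
  group = record
    { Carrier        = ℤ/ n
    ; _∙_            = _⊕_
    ; ε              = 0#
    ; _⁻¹            = ⊖_
    ; isAbelianGroup = isAbelianGroup-≡ ⊕-assoc ⊕-comm ⊕-identityˡ ⊕-inverseˡ
    ; _≟_            = _≟ᶠ_
    }

  open DecAbelianGroup group using (double; double^; HasOrderTwo; AtMostOneOrderTwo; DoublingStabilises)

  toℕ-double^ : ∀ j x → toℕ (double^ j x) ≡ (2 ^ j * toℕ x) % n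
  toℕ-double^ zero    x = trans (sym (toℕ%n x)) (cong (_% n) (sym (*-identityˡ (toℕ x))))
  toℕ-double^ (suc j) x = begin
    toℕ (double^ j x ⊕ double^ j x)              ≡⟨ toℕ-⊕ (double^ j x) (double^ j x) ⟩
    (toℕ (double^ j x) + toℕ (double^ j x)) % n  ≡⟨ cong (λ t → (t + t) % n) (toℕ-double^ j x) ⟩
    (A % n + A % n) % n                          ≡⟨ [m%n+k]%n A (A % n) ⟩
    (A + A % n) % n                              ≡⟨ [m+k%n]%n A A ⟩
    (A + A) % n                                  ≡⟨ cong (λ t → (A + t) % n) (+-identityʳ A) ⟨
    (2 * A) % n                                  ≡⟨ cong (_% n) (*-assoc 2 (2 ^ j) (toℕ x)) ⟨
    (2 ^ suc j * toℕ x) % n                      ∎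
    where open ≡-Reasoning
          A = 2 ^ j * toℕ x

  double^≡0⇒∣ : ∀ j x → double^ j x ≡ 0# → n ∣ 2 ^ j * toℕ x
  double^≡0⇒∣ j x eq = m%n≡0⇒n∣m _ n (trans (sym (toℕ-double^ j x)) (trans (cong toℕ eq) toℕ-0#))

  ∣⇒double^≡0 : ∀ j x → n ∣ 2 ^ j * toℕ x → double^ j x ≡ 0#
  ∣⇒double^≡0 j x n∣ = toℕ-injective (trans (toℕ-double^ j x) (trans (n∣m⇒m%n≡0 _ n n∣) (sym toℕ-0#)))

  doublingStabilises : ∀ {N} → n ≤ N → DoublingStabilises N
  doublingStabilises n≤N j x N≤j 2^[1+j]x≡0 = ∣⇒double^≡0 j x
    (∣2^suc*⇒∣2^* j (toℕ x) (>-nonZero⁻¹ n) (≤-trans n≤N N≤j) (double^≡0⇒∣ (suc j) x 2^[1+j]x≡0))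

  order-two⇒twice≡n : ∀ {x} → HasOrderTwo x → 2 * toℕ x ≡ n
  order-two⇒twice≡n {x} (x≢0 , 2x≡0) with double^≡0⇒∣ 1 x 2x≡0
  ... | divides zero 2x≡0*n =
    contradiction (toℕ-injective (trans (*-cancelˡ-≡ (toℕ x) 0 2 2x≡0*n) (sym toℕ-0#))) x≢0
  ... | divides (suc zero) 2x≡n = trans 2x≡n (+-identityʳ n)
  ... | divides (suc (suc q)) 2x≡[2+q]n = contradiction 2x≡[2+q]n (<⇒≢ (begin-strict
    2 * toℕ x          <⟨ *-monoʳ-< 2 (toℕ<n x) ⟩
    2 * n              ≤⟨ *-monoˡ-≤ n {2} {suc (suc q)} (s≤s (s≤s z≤n)) ⟩
    suc (suc q) * n    ∎))
    where open ≤-Reasoning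

  atMostOneOrderTwo : AtMostOneOrderTwo
  atMostOneOrderTwo ox oy =
    toℕ-injective (*-cancelˡ-≡ _ _ 2 (trans (order-two⇒twice≡n ox) (sym (order-two⇒twice≡n oy))))

infixr 2 _×ᴳ_
_×ᴳ_ : DecAbelianGroup → DecAbelianGroup → DecAbelianGroup
A ×ᴳ B = record
  { Carrier        = A.Carrier × B.Carrier
  ; _∙_            = addProd A._∙_ B._∙_
  ; ε              = A.ε , B.ε
  ; _⁻¹            = λ (x , y) → x A.⁻¹ , y B.⁻¹
  ; isAbelianGroup = isAbelianGroup-≡
      (λ _ _ _ → cong₂ _,_ (A.assoc _ _ _) (B.assoc _ _ _))
      (λ _ _ → cong₂ _,_ (A.comm _ _) (B.comm _ _))
      (λ _ → cong₂ _,_ (A.identityˡ _) (B.identityˡ _))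
      (λ _ → cong₂ _,_ (A.inverseˡ _) (B.inverseˡ _))
  ; _≟_            = ≡-dec A._≟_ B._≟_
  }
  where module A = DecAbelianGroup A
        module B = DecAbelianGroup B

transpose-matchˡ : ∀ {n} (i j : Fin n) → transpose i j ⟨$⟩ʳ i ≡ j
transpose-matchˡ i j rewrite dec-true (i ≟ᶠ i) refl = refl

⟨$⟩ʳ-injective : ∀ {n} (π : Permutation′ n) {i j} → π ⟨$⟩ʳ i ≡ π ⟨$⟩ʳ j → i ≡ j
⟨$⟩ʳ-injective π eq =
  trans (sym (Permutation.inverseˡ π)) (trans (cong (π ⟨$⟩ˡ_) eq) (Permutation.inverseˡ π))

module Colouring (G : DecAbelianGroup) where

  open DecAbelianGroup G

  module _ {r} (c : Carrier → Fin r) where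

    Rainbow : Carrier → Carrier → Set
    Rainbow a d = c a ≢ c (a ∙ d) × c a ≢ c (a ∙ d ∙ d) × c (a ∙ d) ≢ c (a ∙ d ∙ d)

    Repeats : Carrier → Carrier → Set
    Repeats a d = c a ≡ c (a ∙ d) ⊎ c a ≡ c (a ∙ d ∙ d) ⊎ c (a ∙ d) ≡ c (a ∙ d ∙ d)

    RainbowFree : Set
    RainbowFree = ∀ a d → Repeats a d

    SoleAtε : Set
    SoleAtε = ∀ x → c x ≡ c ε → x ≡ ε

    InversionInvariant : Set
    InversionInvariant = ∀ x → c (x ⁻¹) ≡ c x

    DoublingInvariant : Set
    DoublingInvariant = ∀ x → double x ≢ ε → c (double x) ≡ c x

    repeats⇒¬rainbow : ∀ {a d} → Repeats a d → ¬ Rainbow a d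
    repeats⇒¬rainbow (inj₁ c₀≡c₁)        (r₀₁ , _ , _) = r₀₁ c₀≡c₁
    repeats⇒¬rainbow (inj₂ (inj₁ c₀≡c₂)) (_ , r₀₂ , _) = r₀₂ c₀≡c₂
    repeats⇒¬rainbow (inj₂ (inj₂ c₁≡c₂)) (_ , _ , r₁₂) = r₁₂ c₁≡c₂

    ¬rainbow⇒repeats : ∀ {a d} → ¬ Rainbow a d → Repeats a d
    ¬rainbow⇒repeats {a} {d} ¬rainbow
      with c a ≟ᶠ c (a ∙ d) | c a ≟ᶠ c (a ∙ d ∙ d) | c (a ∙ d) ≟ᶠ c (a ∙ d ∙ d)
    ... | yes c₀≡c₁ | _         | _         = inj₁ c₀≡c₁
    ... | no  _     | yes c₀≡c₂ | _         = inj₂ (inj₁ c₀≡c₂)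
    ... | no  _     | no  _     | yes c₁≡c₂ = inj₂ (inj₂ c₁≡c₂)
    ... | no  r₀₁   | no  r₀₂   | no  r₁₂   = contradiction (r₀₁ , r₀₂ , r₁₂) ¬rainbow

    rainbow? : ∀ a d → Dec (Rainbow a d)
    rainbow? a d = ¬? (c a ≟ᶠ c (a ∙ d)) ×-dec ¬? (c a ≟ᶠ c (a ∙ d ∙ d)) ×-dec ¬? (c (a ∙ d) ≟ᶠ c (a ∙ d ∙ d))

    hasRainbowAP⇒rainbow : HasRainbowAP _∙_ 3 c → ∃₂ Rainbow
    hasRainbowAP⇒rainbow (a , d , rainbow) =
      a , d , rainbow 0 1 z<s (s≤s z<s) , rainbow 0 2 z<s (s≤s (s≤s z<s)) ,
      rainbow 1 2 (s≤s z<s) (s≤s (s≤s z<s))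

    rainbowFree⇒¬hasRainbowAP : RainbowFree → ¬ HasRainbowAP _∙_ 3 c
    rainbowFree⇒¬hasRainbowAP free has-rainbow with hasRainbowAP⇒rainbow has-rainbow
    ... | a , d , rainbow = repeats⇒¬rainbow (free a d) rainbow

    rainbow⇒hasRainbowAP : ∀ {a d} → Rainbow a d → HasRainbowAP _∙_ 3 c
    rainbow⇒hasRainbowAP {a} {d} (r₀₁ , r₀₂ , r₁₂) = a , d , λ where
      0 1 _ _ → r₀₁
      0 2 _ _ → r₀₂
      1 2 _ _ → r₁₂
      (suc (suc _)) 2 (s≤s (s≤s ())) _
      _ (suc (suc (suc _))) _ (s≤s (s≤s (s≤s ())))
      (suc _) 1 (s≤s ()) _

  module _ {r} {c : Carrier → Fin r} (sole : SoleAtε c) (free : RainbowFree c) where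

    private
      ≡ε⇒inversionInvariant : ∀ {x} → x ≡ ε → c (x ⁻¹) ≡ c x
      ≡ε⇒inversionInvariant refl = cong c ε⁻¹≈ε

      x⁻¹∙x∙x≡x : ∀ x → x ⁻¹ ∙ x ∙ x ≡ x
      x⁻¹∙x∙x≡x x = trans (cong (_∙ x) (inverseˡ x)) (identityˡ x)

    inversionInvariant : InversionInvariant c
    inversionInvariant x with free (x ⁻¹) x
    ... | inj₁ c[x⁻¹]≡c[x⁻¹x] = ≡ε⇒inversionInvariant
      (⁻¹≡ε⇒≡ε (sole (x ⁻¹) (trans c[x⁻¹]≡c[x⁻¹x] (cong c (inverseˡ x)))))
    ... | inj₂ (inj₁ c[x⁻¹]≡c[x⁻¹xx]) = trans c[x⁻¹]≡c[x⁻¹xx] (cong c (x⁻¹∙x∙x≡x x))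
    ... | inj₂ (inj₂ c[x⁻¹x]≡c[x⁻¹xx]) = ≡ε⇒inversionInvariant (sole x (begin
      c x              ≡⟨ cong c (x⁻¹∙x∙x≡x x) ⟨
      c (x ⁻¹ ∙ x ∙ x) ≡⟨ c[x⁻¹x]≡c[x⁻¹xx] ⟨
      c (x ⁻¹ ∙ x)     ≡⟨ cong c (inverseˡ x) ⟩
      c ε              ∎))
      where open ≡-Reasoning

    doublingInvariant : DoublingInvariant c
    doublingInvariant x 2x≢ε with free ε x
    ... | inj₁ c[ε]≡c[εx] = contradiction (trans (cong double x≡ε) double-ε) 2x≢ε
      where x≡ε = trans (sym (identityˡ x)) (sole _ (sym c[ε]≡c[εx]))
    ... | inj₂ (inj₁ c[ε]≡c[εxx]) = contradiction (trans (sym (ε∙x∙x≡double x)) (sole _ (sym c[ε]≡c[εxx]))) 2x≢ε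
    ... | inj₂ (inj₂ c[εx]≡c[εxx]) =
      trans (cong c (sym (ε∙x∙x≡double x))) (trans (sym c[εx]≡c[εxx]) (cong c (identityˡ x)))

  module _ {r} {c : Carrier → Fin r} (dbl : DoublingInvariant c) where

    doublingInvariant-double^ : ∀ j x → double^ j x ≢ ε → c (double^ j x) ≡ c x
    doublingInvariant-double^ zero    x _        = refl
    doublingInvariant-double^ (suc j) x 2^[1+j]x≢ε =
      trans (dbl (double^ j x) 2^[1+j]x≢ε) (doublingInvariant-double^ j x 2^jx≢ε)
      where 2^jx≢ε = λ 2^jx≡ε → 2^[1+j]x≢ε (trans (cong double 2^jx≡ε) double-ε)

    -- Doubling leads every element of 2-power order to the unique element of order two.
    2-primary-monochromatic : AtMostOneOrderTwo → ∀ {N x y} → x ≢ ε → y ≢ ε →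
      double^ N x ≡ ε → double^ N y ≡ ε → c x ≡ c y
    2-primary-monochromatic unique {N} {x} {y} x≢ε y≢ε 2^Nx≡ε 2^Ny≡ε
      with double^-reaches-order-two N x x≢ε 2^Nx≡ε | double^-reaches-order-two N y y≢ε 2^Ny≡ε
    ... | i , ox | i′ , oy = begin
      c x              ≡⟨ doublingInvariant-double^ i x (proj₁ ox) ⟨
      c (double^ i x)  ≡⟨ cong c (unique ox oy) ⟩
      c (double^ i′ y) ≡⟨ doublingInvariant-double^ i′ y (proj₁ oy) ⟩
      c y              ∎
      where open ≡-Reasoning

  module _ {r} {c : Carrier → Fin r} (inv : InversionInvariant c) (dbl : DoublingInvariant c) where

    repeats-through-ε : ∀ {a d} → a ≡ ε ⊎ a ∙ d ≡ ε ⊎ a ∙ d ∙ d ≡ ε → Repeats c a d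
    repeats-through-ε {d = d} (inj₁ refl) with double d ≟ ε
    ... | yes 2d≡ε = inj₂ (inj₁ (cong c (sym (trans (ε∙x∙x≡double d) 2d≡ε))))
    ... | no  2d≢ε = inj₂ (inj₂ (begin
      c (ε ∙ d)      ≡⟨ cong c (identityˡ d) ⟩
      c d            ≡⟨ dbl d 2d≢ε ⟨
      c (double d)   ≡⟨ cong c (ε∙x∙x≡double d) ⟨
      c (ε ∙ d ∙ d)  ∎))
      where open ≡-Reasoning
    repeats-through-ε {a} {d} (inj₂ (inj₁ a∙d≡ε)) = inj₂ (inj₁ (begin
      c a            ≡⟨ cong c (inverseˡ-unique a d a∙d≡ε) ⟩
      c (d ⁻¹)       ≡⟨ inv d ⟩
      c d            ≡⟨ cong c (trans (cong (_∙ d) a∙d≡ε) (identityˡ d)) ⟨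
      c (a ∙ d ∙ d)  ∎))
      where open ≡-Reasoning
    repeats-through-ε {a} {d} (inj₂ (inj₂ a∙d∙d≡ε)) with double (a ∙ d) ≟ ε
    ... | yes 2[a∙d]≡ε = inj₂ (inj₁ (cong c (trans a≡double (trans 2[a∙d]≡ε (sym a∙d∙d≡ε)))))
      where a≡double = x∙y∙y≡ε⇒x≡double[x∙y] a∙d∙d≡ε
    ... | no  2[a∙d]≢ε = inj₁ (trans (cong c a≡double) (dbl (a ∙ d) 2[a∙d]≢ε))
      where a≡double = x∙y∙y≡ε⇒x≡double[x∙y] a∙d∙d≡ε

    rainbow-avoids-ε : ∀ {a d} → Rainbow c a d → a ≢ ε × a ∙ d ≢ ε × a ∙ d ∙ d ≢ ε
    rainbow-avoids-ε rainbow =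
        (λ z → repeats⇒¬rainbow c (repeats-through-ε (inj₁ z)) rainbow)
      , (λ z → repeats⇒¬rainbow c (repeats-through-ε (inj₂ (inj₁ z))) rainbow)
      , (λ z → repeats⇒¬rainbow c (repeats-through-ε (inj₂ (inj₂ z))) rainbow)

  module _ {r} {c : Carrier → Fin r} (S Q : Carrier → Set) (Q? : ∀ x → Dec (Q x))
           (mono-Q  : ∀ {x y} → S x → S y → Q x → Q y → c x ≡ c y)
           (mono-¬Q : ∀ {x y} → S x → S y → ¬ Q x → ¬ Q y → c x ≡ c y) where

    two-monochromatic-classes⇒¬rainbow : ∀ {a d} → S a → S (a ∙ d) → S (a ∙ d ∙ d) → ¬ Rainbow c a d
    two-monochromatic-classes⇒¬rainbow {a} {d} s₀ s₁ s₂ (r₀₁ , r₀₂ , r₁₂)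
      with Q? a | Q? (a ∙ d) | Q? (a ∙ d ∙ d)
    ... | yes q₀ | yes q₁ | _      = r₀₁ (mono-Q s₀ s₁ q₀ q₁)
    ... | no  q₀ | no  q₁ | _      = r₀₁ (mono-¬Q s₀ s₁ q₀ q₁)
    ... | yes q₀ | no  _  | yes q₂ = r₀₂ (mono-Q s₀ s₂ q₀ q₂)
    ... | no  q₀ | yes _  | no  q₂ = r₀₂ (mono-¬Q s₀ s₂ q₀ q₂)
    ... | yes _  | no  q₁ | no  q₂ = r₁₂ (mono-¬Q s₁ s₂ q₁ q₂)
    ... | no  _  | yes q₁ | yes q₂ = r₁₂ (mono-Q s₁ s₂ q₁ q₂)

  record Normalised {k} (c : Carrier → Fin (suc k)) : Set where
    field
      colour-ε : c ε ≡ 0F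
      exact    : Exact c
      sole     : SoleAtε c
      free     : RainbowFree c

  -- Translate the sole point to ε and swap its colour with 0F.
  normalise : ∀ {k} {c : Carrier → Fin (suc k)} → Exact c → Unitary c → RainbowFree c →
    Σ (Carrier → Fin (suc k)) Normalised
  normalise {k} {c} exact (u , u-sole) free = c′ , record
    { colour-ε = trans (cong (λ x → π ⟨$⟩ʳ c x) (identityˡ u)) (transpose-matchˡ (c u) 0F)
    ; exact    = c′-exact
    ; sole     = λ x c′x≡c′ε → ∙-cancelʳ u x ε
                   (trans (u-sole (x ∙ u) (trans (⟨$⟩ʳ-injective π c′x≡c′ε) (cong c (identityˡ u))))
                          (sym (identityˡ u)))
    ; free     = λ a d → Sum.map (recolour refl (shift a d))
                           (Sum.map (recolour refl (shift₂ a d)) (recolour (shift a d) (shift₂ a d)))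
                           (free (a ∙ u) d)
    }
    where
    π : Permutation′ (suc k)
    π = transpose (c u) 0F

    c′ : Carrier → Fin (suc k)
    c′ x = π ⟨$⟩ʳ c (x ∙ u)

    c′-exact : Exact c′
    c′-exact j with exact (π ⟨$⟩ˡ j)
    ... | y , cy≡π⁻¹j = y ∙ u ⁻¹ , trans (cong (λ x → π ⟨$⟩ʳ c x) (//-rightDividesˡ u y))
                                          (trans (cong (π ⟨$⟩ʳ_) cy≡π⁻¹j) (Permutation.inverseʳ π))

    shift : ∀ x d → x ∙ d ∙ u ≡ x ∙ u ∙ d
    shift x d = xy∙z≈xz∙y x d u

    shift₂ : ∀ x d → x ∙ d ∙ d ∙ u ≡ x ∙ u ∙ d ∙ d
    shift₂ x d = trans (shift (x ∙ d) d) (cong (_∙ d) (shift x d))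

    recolour : ∀ {x y x′ y′} → x ∙ u ≡ x′ → y ∙ u ≡ y′ → c x′ ≡ c y′ → c′ x ≡ c′ y
    recolour x∙u≡x′ y∙u≡y′ cx′≡cy′ =
      cong (π ⟨$⟩ʳ_) (trans (cong c x∙u≡x′) (trans cx′≡cy′ (cong c (sym y∙u≡y′))))

module Pullback (G H : DecAbelianGroup) where

  private
    module G = DecAbelianGroup G
    module H = DecAbelianGroup H
  open Colouring

  module _ (φ : G.Carrier → H.Carrier) (φ-∙ : ∀ x y → φ (x G.∙ y) ≡ φ x H.∙ φ y)
           {r r′} {c : G.Carrier → Fin r} {c′ : H.Carrier → Fin r′} (S : G.Carrier → Set)
           (transfer : ∀ {x y} → S x → S y → c′ (φ x) ≡ c′ (φ y) →
                       (φ x ≡ H.ε × φ y ≡ H.ε) ⊎ c x ≡ c y) where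

    image-repeat⇒vanishes : ∀ {a d} → (H.double (φ d) ≡ H.ε → φ d ≡ H.ε) →
      S a → S (a G.∙ d) → S (a G.∙ d G.∙ d) →
      Repeats H c′ (φ a) (φ d) → Rainbow G c a d → φ a ≡ H.ε × φ d ≡ H.ε
    image-repeat⇒vanishes {a} {d} 2-torsion-free s₀ s₁ s₂ repeat (r₀₁ , r₀₂ , r₁₂) = from repeat
      where
      Q₁ : φ (a G.∙ d) ≡ φ a H.∙ φ d
      Q₁ = φ-∙ a d
      Q₂ : φ (a G.∙ d G.∙ d) ≡ φ a H.∙ φ d H.∙ φ d
      Q₂ = trans (φ-∙ (a G.∙ d) d) (cong (H._∙ φ d) Q₁)
      from : Repeats H c′ (φ a) (φ d) → φ a ≡ H.ε × φ d ≡ H.ε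
      from (inj₁ c₀≡c₁) with transfer s₀ s₁ (trans c₀≡c₁ (cong c′ (sym Q₁)))
      ... | inj₁ (φa≡ε , φ₁≡ε) = φa≡ε , H.AP-ε₀₁ φa≡ε (trans (sym Q₁) φ₁≡ε)
      ... | inj₂ c-repeat      = ⊥-elim (r₀₁ c-repeat)
      from (inj₂ (inj₁ c₀≡c₂)) with transfer s₀ s₂ (trans c₀≡c₂ (cong c′ (sym Q₂)))
      ... | inj₁ (φa≡ε , φ₂≡ε) = φa≡ε , 2-torsion-free (H.AP-ε₀₂ φa≡ε (trans (sym Q₂) φ₂≡ε))
      ... | inj₂ c-repeat      = ⊥-elim (r₀₂ c-repeat)
      from (inj₂ (inj₂ c₁≡c₂)) with transfer s₁ s₂ (trans (cong c′ Q₁) (trans c₁≡c₂ (cong c′ (sym Q₂))))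
      ... | inj₁ (φ₁≡ε , φ₂≡ε) = H.AP-ε₁₂ (trans (sym Q₁) φ₁≡ε) (trans (sym Q₂) φ₂≡ε)
      ... | inj₂ c-repeat      = ⊥-elim (r₁₂ c-repeat)

module _ (G : DecAbelianGroup) where

  open DecAbelianGroup G
  open Colouring G
  open Pullback G G

  rainbow-under-double^ : ∀ {r} {c : Carrier → Fin r} → SoleAtε c → DoublingInvariant c →
    ∀ N → (∀ x → double (double^ N x) ≡ ε → double^ N x ≡ ε) → ∀ {a d} → Rainbow c a d →
    (double^ N a ≡ ε × double^ N d ≡ ε) ⊎ Rainbow c (double^ N a) (double^ N d)
  rainbow-under-double^ {c = c} sole dbl N image-2-torsion-free {a} {d} rainbow
    with rainbow? c (double^ N a) (double^ N d)
  ... | yes image-rainbow = inj₂ image-rainbow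
  ... | no  ¬image-rainbow = inj₁ (image-repeat⇒vanishes (double^ N) (double^-∙ N) {c = c} {c′ = c} (λ _ → ⊤)
          (λ _ _ → transfer) (image-2-torsion-free d) _ _ _ (¬rainbow⇒repeats c ¬image-rainbow) rainbow)
    where
    transfer : ∀ {x y} → c (double^ N x) ≡ c (double^ N y) →
      (double^ N x ≡ ε × double^ N y ≡ ε) ⊎ c x ≡ c y
    transfer {x} {y} c[Mx]≡c[My] with double^ N x ≟ ε
    ... | yes Mx≡ε = inj₁ (Mx≡ε , sole (double^ N y) (trans (sym c[Mx]≡c[My]) (cong c Mx≡ε)))
    ... | no  Mx≢ε = inj₂ (begin
      c x              ≡⟨ doublingInvariant-double^ dbl N x Mx≢ε ⟨
      c (double^ N x)  ≡⟨ c[Mx]≡c[My] ⟩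
      c (double^ N y)  ≡⟨ doublingInvariant-double^ dbl N y My≢ε ⟩
      c y              ∎)
      where open ≡-Reasoning
            My≢ε = λ My≡ε → Mx≢ε (sole (double^ N x) (trans c[Mx]≡c[My] (cong c My≡ε)))

-- Palettes with s + 1 and t + 1 colours glued along their colour 0F.
module Palette (s t : ℕ) where

  left : Fin (suc s) → Fin (suc s + t)
  left i = i ↑ˡ t

  right : Fin (suc t) → Fin (suc s + t)
  right 0F      = 0F
  right (suc j) = suc s ↑ʳ j

  left-injective : ∀ {i i′} → left i ≡ left i′ → i ≡ i′
  left-injective = ↑ˡ-injective t _ _

  right-injective : ∀ {j j′} → right j ≡ right j′ → j ≡ j′
  right-injective {0F}    {0F}     _  = refl
  right-injective {suc j} {suc j′} eq = cong suc (↑ʳ-injective (suc s) j j′ eq)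

  left-or-right-suc : ∀ k → (∃[ i ] left i ≡ k) ⊎ (∃[ j ] right (suc j) ≡ k)
  left-or-right-suc k with splitAt (suc s) k in eq
  ... | inj₁ i = inj₁ (i , splitAt⁻¹-↑ˡ eq)
  ... | inj₂ j = inj₂ (j , splitAt⁻¹-↑ʳ eq)

module Product (A B : DecAbelianGroup) (N : ℕ)
  (A-stable : DecAbelianGroup.DoublingStabilises A N) (B-stable : DecAbelianGroup.DoublingStabilises B N)
  (A-unique : DecAbelianGroup.AtMostOneOrderTwo A) (B-unique : DecAbelianGroup.AtMostOneOrderTwo B)
  {s t} {c₁ : DecAbelianGroup.Carrier A → Fin (suc s)} {c₂ : DecAbelianGroup.Carrier B → Fin (suc t)}
  (n₁ : Colouring.Normalised A c₁) (n₂ : Colouring.Normalised B c₂) where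

  private
    module A = DecAbelianGroup A
    module B = DecAbelianGroup B
    module n₁ = Colouring.Normalised n₁
    module n₂ = Colouring.Normalised n₂
    module C₁ = Colouring A
    module C₂ = Colouring B

  open DecAbelianGroup (A ×ᴳ B)
  open Colouring (A ×ᴳ B)
  open Palette s t

  proj₁-double^ : ∀ j P → proj₁ (double^ j P) ≡ A.double^ j (proj₁ P)
  proj₁-double^ zero    P = refl
  proj₁-double^ (suc j) P = cong A.double (proj₁-double^ j P)

  proj₂-double^ : ∀ j P → proj₂ (double^ j P) ≡ B.double^ j (proj₂ P)
  proj₂-double^ zero    P = refl
  proj₂-double^ (suc j) P = cong B.double (proj₂-double^ j P)

  -- The 2-part of the order of x exceeds that of y; by DoublingStabilises, j ≤ N suffices.
  LeftDominant : Carrier → Set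
  LeftDominant (x , y) = ∃[ j ] j < suc N × B.double^ j y ≡ B.ε × A.double^ j x ≢ A.ε

  leftDominant? : ∀ P → Dec (LeftDominant P)
  leftDominant? (x , y) = anyUpTo? (λ j → (B.double^ j y B.≟ B.ε) ×-dec ¬? (A.double^ j x A.≟ A.ε)) (suc N)

  colour : Carrier → Fin (suc s + t)
  colour (x , y) with leftDominant? (x , y)
  ... | yes _ = left (c₁ x)
  ... | no  _ = right (c₂ y)

  colour-left : ∀ {P} → LeftDominant P → colour P ≡ left (c₁ (proj₁ P))
  colour-left {P} dominant with leftDominant? P
  ... | yes _         = refl
  ... | no  ¬dominant = contradiction dominant ¬dominant

  colour-right : ∀ {P} → ¬ LeftDominant P → colour P ≡ right (c₂ (proj₂ P))
  colour-right {P} ¬dominant with leftDominant? P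
  ... | yes dominant = contradiction dominant ¬dominant
  ... | no  _        = refl

  dominant⇒≢ε : ∀ {x y} → LeftDominant (x , y) → x ≢ A.ε
  dominant⇒≢ε (j , _ , _ , 2^jx≢ε) refl = 2^jx≢ε (A.double^-ε j)

  ε-dominant : ∀ {x} → x ≢ A.ε → LeftDominant (x , B.ε)
  ε-dominant x≢ε = 0 , z<s , refl , x≢ε

  ¬dominant⇒≢ε : ∀ {x y} → ¬ LeftDominant (x , y) → (x , y) ≢ ε → y ≢ B.ε
  ¬dominant⇒≢ε {x} ¬dominant P≢ε refl with x A.≟ A.ε
  ... | yes x≡ε = P≢ε (cong (_, B.ε) x≡ε)
  ... | no  x≢ε = ¬dominant (ε-dominant x≢ε)

  dominant-⁻¹ : ∀ {P} → LeftDominant P → LeftDominant (P ⁻¹)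
  dominant-⁻¹ (j , j≤N , 2^jy≡ε , 2^jx≢ε) =
    j , j≤N , trans (B.double^-⁻¹ j _) (trans (cong B._⁻¹ 2^jy≡ε) B.ε⁻¹≈ε) ,
    λ 2^j[x⁻¹]≡ε → 2^jx≢ε (A.⁻¹≡ε⇒≡ε (trans (sym (A.double^-⁻¹ j _)) 2^j[x⁻¹]≡ε))

  dominant-double : ∀ {P} → double P ≢ ε → LeftDominant P → LeftDominant (double P)
  dominant-double {x , y} 2P≢ε (zero , _ , y≡ε , _) with A.double x A.≟ A.ε
  ... | yes 2x≡ε = contradiction (cong₂ _,_ 2x≡ε (trans (cong B.double y≡ε) B.double-ε)) 2P≢ε
  ... | no  2x≢ε = 0 , z<s , trans (cong B.double y≡ε) B.double-ε , 2x≢ε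
  dominant-double {x , y} 2P≢ε (suc j , 1+j≤N , 2^[1+j]y≡ε , 2^[1+j]x≢ε) =
    j , m<n⇒m<1+n (s≤s⁻¹ 1+j≤N) , trans (sym (B.double^-suc j y)) 2^[1+j]y≡ε ,
    λ 2^j[2x]≡ε → 2^[1+j]x≢ε (trans (A.double^-suc j x) 2^j[2x]≡ε)

  dominant-double⁻¹ : ∀ {P} → LeftDominant (double P) → LeftDominant P
  dominant-double⁻¹ {x , y} (j , j<1+N , 2^j[2y]≡ε , 2^j[2x]≢ε) with suc j <? suc N
  ... | yes 1+j<1+N = suc j , 1+j<1+N , 2^[1+j]y≡ε , 2^[1+j]x≢ε
    where
    2^[1+j]y≡ε = trans (B.double^-suc j y) 2^j[2y]≡ε
    2^[1+j]x≢ε = λ 2^[1+j]x≡ε → 2^j[2x]≢ε (trans (sym (A.double^-suc j x)) 2^[1+j]x≡ε)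
  ... | no  1+j≮1+N =
    j , j<1+N , B-stable j y (s≤s⁻¹ (≮⇒≥ 1+j≮1+N)) (trans (B.double^-suc j y) 2^j[2y]≡ε) ,
    λ 2^jx≡ε → 2^j[2x]≢ε (trans (sym (A.double^-suc j x)) (trans (cong A.double 2^jx≡ε) A.double-ε))

  ¬dominant-ε : ∀ {y} → ¬ LeftDominant (A.ε , y)
  ¬dominant-ε dominant = dominant⇒≢ε dominant refl

  colour-ε : colour ε ≡ 0F
  colour-ε = trans (colour-right ¬dominant-ε) (cong right n₂.colour-ε)

  colour-inversionInvariant : InversionInvariant colour
  colour-inversionInvariant P@(x , y) = by-dominance (leftDominant? P)
    where
    open ≡-Reasoning
    by-dominance : Dec (LeftDominant P) → colour (P ⁻¹) ≡ colour P
    by-dominance (yes dominant) = begin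
      colour (P ⁻¹)        ≡⟨ colour-left (dominant-⁻¹ dominant) ⟩
      left (c₁ (x A.⁻¹))   ≡⟨ cong left (C₁.inversionInvariant n₁.sole n₁.free x) ⟩
      left (c₁ x)          ≡⟨ colour-left dominant ⟨
      colour P             ∎
    by-dominance (no ¬dominant) = begin
      colour (P ⁻¹)        ≡⟨ colour-right (¬dominant ∘ subst LeftDominant (⁻¹-involutive P) ∘ dominant-⁻¹) ⟩
      right (c₂ (y B.⁻¹))  ≡⟨ cong right (C₂.inversionInvariant n₂.sole n₂.free y) ⟩
      right (c₂ y)         ≡⟨ colour-right ¬dominant ⟨
      colour P             ∎

  colour-doublingInvariant : DoublingInvariant colour
  colour-doublingInvariant P@(x , y) 2P≢ε = by-dominance (leftDominant? P)
    where
    open ≡-Reasoning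
    by-dominance : Dec (LeftDominant P) → colour (double P) ≡ colour P
    by-dominance (yes dominant) = begin
      colour (double P)      ≡⟨ colour-left 2P-dominant ⟩
      left (c₁ (A.double x)) ≡⟨ cong left (C₁.doublingInvariant n₁.sole n₁.free x (dominant⇒≢ε 2P-dominant)) ⟩
      left (c₁ x)            ≡⟨ colour-left dominant ⟨
      colour P               ∎
      where 2P-dominant = dominant-double 2P≢ε dominant
    by-dominance (no ¬dominant) = begin
      colour (double P)       ≡⟨ colour-right ¬2P-dominant ⟩
      right (c₂ (B.double y)) ≡⟨ cong right (C₂.doublingInvariant n₂.sole n₂.free y 2y≢ε) ⟩
      right (c₂ y)            ≡⟨ colour-right ¬dominant ⟨
      colour P                ∎
      where ¬2P-dominant = ¬dominant ∘ dominant-double⁻¹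
            2y≢ε = ¬dominant⇒≢ε ¬2P-dominant 2P≢ε

  colour-sole : SoleAtε colour
  colour-sole P@(x , y) cP≡cε with P ≟ ε
  ... | yes P≡ε = P≡ε
  ... | no  P≢ε = ⊥-elim (by-dominance (leftDominant? P))
    where
    open ≡-Reasoning
    by-dominance : Dec (LeftDominant P) → ⊥
    by-dominance (yes dominant) = dominant⇒≢ε dominant (n₁.sole x (left-injective (begin
      left (c₁ x)   ≡⟨ colour-left dominant ⟨
      colour P      ≡⟨ cP≡cε ⟩
      colour ε      ≡⟨ colour-ε ⟩
      left 0F       ≡⟨ cong left n₁.colour-ε ⟨
      left (c₁ A.ε) ∎)))
    by-dominance (no ¬dominant) = ¬dominant⇒≢ε ¬dominant P≢ε (n₂.sole y (right-injective (begin
      right (c₂ y)   ≡⟨ colour-right ¬dominant ⟨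
      colour P       ≡⟨ cP≡cε ⟩
      colour ε       ≡⟨ colour-ε ⟩
      right 0F       ≡⟨ cong right n₂.colour-ε ⟨
      right (c₂ B.ε) ∎)))

  colour-exact : Exact colour
  colour-exact k with left-or-right-suc k
  ... | inj₂ (j , right[1+j]≡k) with n₂.exact (suc j)
  ...   | y , c₂y≡1+j = (A.ε , y) , trans (colour-right ¬dominant-ε) (trans (cong right c₂y≡1+j) right[1+j]≡k)
  colour-exact k | inj₁ (i , left-i≡k) with n₁.exact i
  ... | x , c₁x≡i with x A.≟ A.ε
  ...   | yes refl = ε , trans colour-ε (trans (cong left (trans (sym n₁.colour-ε) c₁x≡i)) left-i≡k)
  ...   | no  x≢ε  = (x , B.ε) , trans (colour-left (ε-dominant x≢ε)) (trans (cong left c₁x≡i) left-i≡k)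

  private
    dbl₁ = C₁.doublingInvariant n₁.sole n₁.free
    dbl₂ = C₂.doublingInvariant n₂.sole n₂.free

    M : Carrier → Carrier
    M = double^ N

  proj₁-M≡ε : ∀ {P} → M P ≡ ε → A.double^ N (proj₁ P) ≡ A.ε
  proj₁-M≡ε {P} MP≡ε = trans (sym (proj₁-double^ N P)) (cong proj₁ MP≡ε)

  proj₂-M≡ε : ∀ {P} → M P ≡ ε → B.double^ N (proj₂ P) ≡ B.ε
  proj₂-M≡ε {P} MP≡ε = trans (sym (proj₂-double^ N P)) (cong proj₂ MP≡ε)

  proj₁-M-2-torsion-free : ∀ P → A.double (proj₁ (M P)) ≡ A.ε → proj₁ (M P) ≡ A.ε
  proj₁-M-2-torsion-free P 2x′≡ε = trans (proj₁-double^ N P)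
    (A.double^-image-2-torsion-free A-stable 1 (proj₁ P)
      (trans (cong A.double (sym (proj₁-double^ N P))) 2x′≡ε))

  proj₂-M-2-torsion-free : ∀ P → B.double (proj₂ (M P)) ≡ B.ε → proj₂ (M P) ≡ B.ε
  proj₂-M-2-torsion-free P 2y′≡ε = trans (proj₂-double^ N P)
    (B.double^-image-2-torsion-free B-stable 1 (proj₂ P)
      (trans (cong B.double (sym (proj₂-double^ N P))) 2y′≡ε))

  M-image-2-torsion-free : ∀ P → double (M P) ≡ ε → M P ≡ ε
  M-image-2-torsion-free P 2MP≡ε =
    cong₂ _,_ (proj₁-M-2-torsion-free P (cong proj₁ 2MP≡ε)) (proj₂-M-2-torsion-free P (cong proj₂ 2MP≡ε))

  M-AP≡ε : ∀ {a d} → M a ≡ ε → M d ≡ ε → M (a ∙ d) ≡ ε × M (a ∙ d ∙ d) ≡ ε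
  M-AP≡ε {a} {d} Ma≡ε Md≡ε =
    trans (double^-∙ N a d) (trans (cong₂ _∙_ Ma≡ε Md≡ε) (identityˡ ε)) ,
    trans (double^-AP₂ N a d)
      (trans (cong₂ (λ u v → u ∙ v ∙ v) Ma≡ε Md≡ε) (trans (cong (_∙ ε) (identityˡ ε)) (identityˡ ε)))

  -- Both sides of the dominance split are monochromatic on the 2-primary part.
  2-primary-¬rainbow : ∀ {a d} → M a ≡ ε → M d ≡ ε → ¬ Rainbow colour a d
  2-primary-¬rainbow {a} {d} Ma≡ε Md≡ε rainbow
    with rainbow-avoids-ε colour-inversionInvariant colour-doublingInvariant rainbow
  ... | a≢ε , a∙d≢ε , a∙d∙d≢ε =
    two-monochromatic-classes⇒¬rainbow S LeftDominant leftDominant? mono-dominant mono-¬dominant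
      (a≢ε , Ma≡ε) (a∙d≢ε , proj₁ (M-AP≡ε Ma≡ε Md≡ε)) (a∙d∙d≢ε , proj₂ (M-AP≡ε Ma≡ε Md≡ε)) rainbow
    where
    S : Carrier → Set
    S P = P ≢ ε × M P ≡ ε
    mono-dominant : ∀ {P P′} → S P → S P′ → LeftDominant P → LeftDominant P′ → colour P ≡ colour P′
    mono-dominant (_ , MP≡ε) (_ , MP′≡ε) dominant dominant′ = trans (colour-left dominant)
      (trans (cong left (C₁.2-primary-monochromatic dbl₁ A-unique {N}
                          (dominant⇒≢ε dominant) (dominant⇒≢ε dominant′)
                          (proj₁-M≡ε MP≡ε) (proj₁-M≡ε MP′≡ε)))
             (sym (colour-left dominant′)))
    mono-¬dominant : ∀ {P P′} → S P → S P′ → ¬ LeftDominant P → ¬ LeftDominant P′ → colour P ≡ colour P′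
    mono-¬dominant (P≢ε , MP≡ε) (P′≢ε , MP′≡ε) ¬dominant ¬dominant′ = trans (colour-right ¬dominant)
      (trans (cong right (C₂.2-primary-monochromatic dbl₂ B-unique {N} (¬dominant⇒≢ε ¬dominant P≢ε)
                           (¬dominant⇒≢ε ¬dominant′ P′≢ε) (proj₂-M≡ε MP≡ε) (proj₂-M≡ε MP′≡ε)))
             (sym (colour-right ¬dominant′)))

  M-dominant⇒proj₂≡ε : ∀ P → LeftDominant (M P) → proj₂ (M P) ≡ B.ε
  M-dominant⇒proj₂≡ε P (j , _ , 2^j[y′]≡ε , _) =
    trans (proj₂-double^ N P) (B.double^-image-2-torsion-free B-stable j (proj₂ P)
      (trans (cong (B.double^ j) (sym (proj₂-double^ N P))) 2^j[y′]≡ε))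

  proj₂≡ε⇒dominant : ∀ {P} → P ≢ ε → proj₂ P ≡ B.ε → LeftDominant P
  proj₂≡ε⇒dominant P≢ε y≡ε = 0 , z<s , y≡ε , λ x≡ε → P≢ε (cong₂ _,_ x≡ε y≡ε)

  colour-over-ε : ∀ {R R′} → R ≢ ε → R′ ≢ ε → proj₂ R ≡ B.ε → proj₂ R′ ≡ B.ε →
    c₁ (proj₁ R) ≡ c₁ (proj₁ R′) → colour R ≡ colour R′
  colour-over-ε R≢ε R′≢ε y≡ε y′≡ε c₁x≡c₁x′ = trans (colour-left (proj₂≡ε⇒dominant R≢ε y≡ε))
    (trans (cong left c₁x≡c₁x′) (sym (colour-left (proj₂≡ε⇒dominant R′≢ε y′≡ε))))

  -- Nonzero points of the image of M: there, dominance happens only over y = ε.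
  Tame : Carrier → Set
  Tame R = R ≢ ε × (LeftDominant R → proj₂ R ≡ B.ε)

  tame-transfer : ∀ {R R′} → Tame R → Tame R′ → c₂ (proj₂ R) ≡ c₂ (proj₂ R′) →
    (proj₂ R ≡ B.ε × proj₂ R′ ≡ B.ε) ⊎ colour R ≡ colour R′
  tame-transfer {R} {R′} (_ , dominant⇒y≡ε) (_ , dominant⇒y′≡ε) c₂y≡c₂y′ with proj₂ R B.≟ B.ε
  ... | yes y≡ε = inj₁ (y≡ε , n₂.sole _ (trans (sym c₂y≡c₂y′) (cong c₂ y≡ε)))
  ... | no  y≢ε = inj₂ (trans (colour-right (y≢ε ∘ dominant⇒y≡ε))
                         (trans (cong right c₂y≡c₂y′) (sym (colour-right (y′≢ε ∘ dominant⇒y′≡ε)))))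
    where y′≢ε = λ y′≡ε → y≢ε (n₂.sole _ (trans c₂y≡c₂y′ (cong c₂ y′≡ε)))

  image-¬rainbow : ∀ a d → ¬ Rainbow colour (M a) (M d)
  image-¬rainbow a d rainbow
    with rainbow-avoids-ε colour-inversionInvariant colour-doublingInvariant rainbow
  ... | R₀≢ε , R₁≢ε , R₂≢ε = over-ε⇒¬rainbow
    (Pullback.image-repeat⇒vanishes (A ×ᴳ B) B proj₂ (λ _ _ → refl) Tame tame-transfer
      (proj₂-M-2-torsion-free d) (R₀≢ε , M-dominant⇒proj₂≡ε a) (R₁≢ε , tame₁) (R₂≢ε , tame₂)
      (n₂.free (proj₂ (M a)) (proj₂ (M d))) rainbow)
    where
    tame₁ : LeftDominant (M a ∙ M d) → proj₂ (M a ∙ M d) ≡ B.ε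
    tame₁ = subst (λ R → LeftDominant R → proj₂ R ≡ B.ε) (double^-∙ N a d) (M-dominant⇒proj₂≡ε (a ∙ d))
    tame₂ : LeftDominant (M a ∙ M d ∙ M d) → proj₂ (M a ∙ M d ∙ M d) ≡ B.ε
    tame₂ = subst (λ R → LeftDominant R → proj₂ R ≡ B.ε) (double^-AP₂ N a d) (M-dominant⇒proj₂≡ε (a ∙ d ∙ d))
    over-ε⇒¬rainbow : proj₂ (M a) ≡ B.ε × proj₂ (M d) ≡ B.ε → ⊥
    over-ε⇒¬rainbow (y₀≡ε , yδ≡ε) = repeats⇒¬rainbow colour (Sum.map (colour-over-ε R₀≢ε R₁≢ε y₀≡ε y₁≡ε)
      (Sum.map (colour-over-ε R₀≢ε R₂≢ε y₀≡ε y₂≡ε) (colour-over-ε R₁≢ε R₂≢ε y₁≡ε y₂≡ε))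
      (n₁.free (proj₁ (M a)) (proj₁ (M d)))) rainbow
      where
      y₁≡ε = trans (cong₂ B._∙_ y₀≡ε yδ≡ε) (B.identityˡ B.ε)
      y₂≡ε = trans (cong₂ B._∙_ y₁≡ε yδ≡ε) (B.identityˡ B.ε)

  colour-free : RainbowFree colour
  colour-free a d = ¬rainbow⇒repeats colour λ rainbow →
    Sum.[ (λ (Ma≡ε , Md≡ε) → 2-primary-¬rainbow Ma≡ε Md≡ε rainbow) , image-¬rainbow a d ]
      (rainbow-under-double^ (A ×ᴳ B) colour-sole colour-doublingInvariant N M-image-2-torsion-free rainbow)

module _ (n : ℕ) .{{_ : NonZero n}} where

  open Colouring (Cyclic.group n)

  allRainbow-by-refutation : ∀ {r} →
    (∀ (c : ℤ/ n → Fin r) → Exact c → Unitary c → RainbowFree c → ⊥) → AllRainbow (ℤ/ n) (addMod n) 3 r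
  allRainbow-by-refutation no-rainbow-free c exact unitary with any? (λ a → any? (λ d → rainbow? c a d))
  ... | yes (a , d , rainbow) = rainbow⇒hasRainbowAP c rainbow
  ... | no  ¬rainbow = ⊥-elim (no-rainbow-free c exact unitary
                                (λ a d → ¬rainbow⇒repeats c (λ rainbow → ¬rainbow (a , d , rainbow))))

¬allRainbow-product : ∀ {p q} .{{_ : NonZero p}} .{{_ : NonZero q}} {s t} →
  ¬ AllRainbow (ℤ/ p) (addMod p) 3 (suc s) → ¬ AllRainbow (ℤ/ q) (addMod q) 3 (suc t) →
  ¬ AllRainbow (ℤ/ p × ℤ/ q) (addProd (addMod p) (addMod q)) 3 (suc s + t)
¬allRainbow-product {p} {q} ¬all₁ ¬all₂ all =
  ¬all₁ (allRainbow-by-refutation p λ c₁ exact₁ unitary₁ free₁ →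
  ¬all₂ (allRainbow-by-refutation q λ c₂ exact₂ unitary₂ free₂ →
    let open Product (Cyclic.group p) (Cyclic.group q) (p + q)
               (Cyclic.doublingStabilises p (m≤m+n p q)) (Cyclic.doublingStabilises q (m≤n+m q p))
               (Cyclic.atMostOneOrderTwo p) (Cyclic.atMostOneOrderTwo q)
               (proj₂ (Colouring.normalise (Cyclic.group p) exact₁ unitary₁ free₁))
               (proj₂ (Colouring.normalise (Cyclic.group q) exact₂ unitary₂ free₂))
    in Colouring.rainbowFree⇒¬hasRainbowAP (Cyclic.group p ×ᴳ Cyclic.group q) colour colour-free
         (all colour colour-exact (_ , colour-sole))))

split-colours : ∀ {l₁ l₂ a b c} → l₁ < a → l₂ < b → l₁ + l₂ ≤ suc c → 2 + c < a + b →
  ∃₂ λ s t → l₁ ≤ s × s < a × l₂ ≤ t × t < b × s + t ≡ suc c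
split-colours {l₁} {l₂} {suc a} {b} {c} l₁<1+a l₂<b l₁+l₂≤1+c 2+c<1+a+b with suc a + l₂ ≤? 2 + c
... | yes 1+a+l₂≤2+c =
  a , suc c ∸ a , s≤s⁻¹ l₁<1+a , n<1+n a ,
  m+n≤o⇒m≤o∸n l₂ (subst (_≤ suc c) (+-comm a l₂) a+l₂≤1+c) ,
  m<n+o⇒m∸n<o (suc c) a {{>-nonZero (≤-trans z<s l₂<b)}} (s<s⁻¹ 2+c<1+a+b) ,
  m+[n∸m]≡n (m+n≤o⇒m≤o a a+l₂≤1+c)
  where a+l₂≤1+c = s≤s⁻¹ 1+a+l₂≤2+c
... | no  1+a+l₂≰2+c =
  suc c ∸ l₂ , l₂ , m+n≤o⇒m≤o∸n l₁ l₁+l₂≤1+c ,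
  m<n+o⇒m∸n<o (suc c) l₂ {{>-nonZero (≤-trans z<s l₁<1+a)}}
    (subst (suc c <_) (+-comm (suc a) l₂) (≤-trans (n≤1+n (suc (suc c))) (≰⇒> 1+a+l₂≰2+c))) ,
  ≤-refl , l₂<b , m∸n+n≡m (m+n≤o⇒n≤o l₁ l₁+l₂≤1+c)

module _ {X : Set} {_⊕_ : X → X → X} {k : ℕ} where

  ¬allRainbow-1 : 2 ≤ k → (x₀ : X) → (∀ x → x ≡ x₀) → ¬ AllRainbow X _⊕_ k 1
  ¬allRainbow-1 2≤k x₀ all≡x₀ all
    with all (λ _ → 0F) (λ { 0F → x₀ , refl }) (x₀ , λ y _ → all≡x₀ y)
  ... | _ , _ , rainbow = rainbow 0 1 z<s 2≤k refl

  ¬allRainbow-2 : DecidableEquality X → ∀ {e x} → x ≢ e → 3 ≤ k → ¬ AllRainbow X _⊕_ k 2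
  ¬allRainbow-2 _≟_ {e} {x} x≢e 3≤k all = no-rainbow (all c exact (e , sole))
    where
    c : X → Fin 2
    c y = if does (y ≟ e) then 0F else 1F
    c-e : c e ≡ 0F
    c-e rewrite dec-true (e ≟ e) refl = refl
    c-≢e : ∀ {y} → y ≢ e → c y ≡ 1F
    c-≢e {y} y≢e rewrite dec-false (y ≟ e) y≢e = refl
    exact : Exact c
    exact 0F = e , c-e
    exact 1F = x , c-≢e x≢e
    sole : ∀ y → c y ≡ c e → y ≡ e
    sole y cy≡ce =
      decidable-stable (y ≟ e) (λ y≢e → contradiction (trans (sym (c-≢e y≢e)) (trans cy≡ce c-e)) λ ())
    no-three-distinct : ∀ {u v w : Fin 2} → u ≢ v → u ≢ w → v ≢ w → ⊥
    no-three-distinct {0F} {0F}         u≢v _   _   = u≢v refl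
    no-three-distinct {1F} {1F}         u≢v _   _   = u≢v refl
    no-three-distinct {0F} {1F} {0F}    _   u≢w _   = u≢w refl
    no-three-distinct {0F} {1F} {1F}    _   _   v≢w = v≢w refl
    no-three-distinct {1F} {0F} {0F}    _   _   v≢w = v≢w refl
    no-three-distinct {1F} {0F} {1F}    _   u≢w _   = u≢w refl
    no-rainbow : ¬ HasRainbowAP _⊕_ k c
    no-rainbow (_ , _ , rainbow) =
      no-three-distinct (rainbow 0 1 z<s (≤-trans (s≤s (s≤s z≤n)) 3≤k))
                        (rainbow 0 2 z<s 3≤k) (rainbow 1 2 (s≤s z<s) 3≤k)

-- The fewest colours an exact unitary colouring of ℤ/ n (n ≥ 1) can use.
fewestColours : ℕ → ℕ
fewestColours 1 = 1
fewestColours _ = 2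

1≤fewestColours : ∀ n → 1 ≤ fewestColours n
1≤fewestColours 1             = s≤s z≤n
1≤fewestColours zero          = s≤s z≤n
1≤fewestColours (suc (suc _)) = s≤s z≤n

fewestColours<awu : ∀ {n} .{{_ : NonZero n}} {a} → IsAwu (ℤ/ n) (addMod n) 3 a → fewestColours n < a
fewestColours<awu {1}           (2≤a , _) = 2≤a
fewestColours<awu {suc (suc _)} (2≤a , all , _) with m≤n⇒m<n∨m≡n 2≤a
... | inj₁ 2<a  = 2<a
... | inj₂ refl = contradiction all (¬allRainbow-2 _≟ᶠ_ {0F} {1F} (λ ()) ≤-refl)

¬allRainbow-below-awu : ∀ {n} .{{_ : NonZero n}} {a s} → IsAwu (ℤ/ n) (addMod n) 3 a →
  fewestColours n ≤ s → s < a → ¬ AllRainbow (ℤ/ n) (addMod n) 3 s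
¬allRainbow-below-awu {s = suc (suc s)} (_ , _ , minimal) _ s<a = minimal _ (s≤s (s≤s z≤n)) s<a
¬allRainbow-below-awu {1}           {s = 1} _ _ _ = ¬allRainbow-1 (s≤s (s≤s z≤n)) 0F λ { 0F → refl ; (suc ()) }
¬allRainbow-below-awu {suc (suc _)} {s = 1} _ (s≤s ()) _
¬allRainbow-below-awu {n}           {s = 0} _ fewest≤0 _ =
  contradiction (≤-trans (1≤fewestColours n) fewest≤0) λ ()

fewestColours≤2 : ∀ n → fewestColours n ≤ 2
fewestColours≤2 1             = s≤s z≤n
fewestColours≤2 zero          = ≤-refl
fewestColours≤2 (suc (suc _)) = ≤-refl

fewestColours-sum≤awu : ∀ {p q} .{{_ : NonZero p}} .{{_ : NonZero q}} {c} →
  IsAwu (ℤ/ p × ℤ/ q) (addProd (addMod p) (addMod q)) 3 c → fewestColours p + fewestColours q ≤ suc c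
fewestColours-sum≤awu {1}           {q} (2≤c , _) = s≤s (≤-trans (fewestColours≤2 q) 2≤c)
fewestColours-sum≤awu {suc (suc _)} {1} (2≤c , _) = s≤s 2≤c
fewestColours-sum≤awu {suc (suc _)} {suc (suc _)} (2≤c , all , _) with m≤n⇒m<n∨m≡n 2≤c
... | inj₁ 2<c  = s≤s 2<c
... | inj₂ refl = contradiction all (¬allRainbow-2 (≡-dec _≟ᶠ_ _≟ᶠ_) {0F , 0F} {1F , 0F} (λ ()) ≤-refl)

¬allRainbow-split : ∀ {p q} .{{_ : NonZero p}} .{{_ : NonZero q}} {a b c s t} →
  IsAwu (ℤ/ p) (addMod p) 3 a → IsAwu (ℤ/ q) (addMod q) 3 b →
  fewestColours p ≤ s → s < a → fewestColours q ≤ t → t < b → s + t ≡ suc c →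
  ¬ AllRainbow (ℤ/ p × ℤ/ q) (addProd (addMod p) (addMod q)) 3 c
¬allRainbow-split {p} {s = 0} _ _ fewest≤0 _ _ _ _ = contradiction (≤-trans (1≤fewestColours p) fewest≤0) λ ()
¬allRainbow-split {q = q} {s = suc _} {t = 0} _ _ _ _ fewest≤0 _ _ =
  contradiction (≤-trans (1≤fewestColours q) fewest≤0) λ ()
¬allRainbow-split {s = suc s} {t = suc t} awu₁ awu₂ fp≤s s<a fq≤t t<b s+t≡1+c
  rewrite sym (suc-injective (trans (sym (+-suc (suc s) t)) s+t≡1+c)) =
  ¬allRainbow-product (¬allRainbow-below-awu awu₁ fp≤s s<a) (¬allRainbow-below-awu awu₂ fq≤t t<b)

proposition13 : (p q : ℕ) .{{_ : NonZero p}} .{{_ : NonZero q}}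
    → (a b c : ℕ)
    → IsAwu (ℤ/ p) (addMod p) 3 a
    → IsAwu (ℤ/ q) (addMod q) 3 b
    → IsAwu (ℤ/ p × ℤ/ q) (addProd (addMod p) (addMod q)) 3 c
    → a + b ≤ c + 2
proposition13 p q a b c awu₁ awu₂ awu with a + b ≤? c + 2
... | yes a+b≤c+2 = a+b≤c+2
... | no  a+b≰c+2
  with split-colours (fewestColours<awu awu₁) (fewestColours<awu awu₂) (fewestColours-sum≤awu awu)
         (subst (_< a + b) (+-comm c 2) (≰⇒> a+b≰c+2))
...   | s , t , fp≤s , s<a , fq≤t , t<b , s+t≡1+c =
  contradiction (proj₁ (proj₂ awu)) (¬allRainbow-split awu₁ awu₂ fp≤s s<a fq≤t t<b s+t≡1+c)
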